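{- Let $p\geqslant 5$ be a prime and let $24_p^{ -1}$ denote the integer satisfying $24\cdot 24_p^{ -1}\equiv 1\pmod p$ chosen so that $1\leqslant -24_p^{ -1}\leqslant p-1$. Then for every integer $\alpha$ with $0\leqslant\alpha\leqslant p-1$ and $\alpha\neq\lfloor p/24\rfloor$, we have $p^2\nmid 24(p\alpha-24_p^{ -1})+1$. -}

module Defs where

module Submission where

-- Put j = −24⁻¹, so that 24 j + 1 = k p with 1 ≤ j < p and hence k < 24. If p² divides
-- 24 (p α + j) + 1 = (24 α + k) p, then 24 α + k = m p with m < 24 (as α < p), and the number
-- equals m p². It is ≡ 1 (mod 24), and so is p² because p is prime to 6; hence m ≡ 1 (mod 24),
-- i.e. m = 1, and p = 24 α + k with k < 24 gives α = ⌊p/24⌋.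

-- A module of its own, so that ℕ's operators do not clash with ℤ's in the statement below.
module ℕ-Arithmetic where

  open import Data.Nat
  open import Data.Nat.Properties
  open import Data.Nat.DivMod
  open import Data.Nat.Divisibility
  open import Data.Nat.Primality using (Prime; prime⇒irreducible)
  open import Data.Nat.Tactic.RingSolver using (solve-∀)
  open import Data.Fin using (Fin; toℕ; fromℕ<)
  open import Data.Fin.Properties using (all?; toℕ-fromℕ<)
  open import Data.Sum using (inj₁; inj₂)
  open import Relation.Binary.PropositionalEquality
  open import Relation.Nullary.Decidable using (toWitness; ¬?; _→-dec_)

  prime⇒∤ : ∀ {p d} → Prime p → 1 < d → d < p → d ∤ p
  prime⇒∤ pr 1<d d<p d∣p with prime⇒irreducible pr d∣p
  ... | inj₁ refl = <-irrefl refl 1<d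
  ... | inj₂ refl = <-irrefl refl d<p

  r<24∧2∤r∧3∤r⇒r*r%24≡1 : ∀ {r} → r < 24 → 2 ∤ r → 3 ∤ r → r * r % 24 ≡ 1
  r<24∧2∤r∧3∤r⇒r*r%24≡1 r<24 = subst P (toℕ-fromℕ< r<24) (table (fromℕ< r<24))
    where
    P : ℕ → Set
    P r = 2 ∤ r → 3 ∤ r → r * r % 24 ≡ 1

    table : ∀ (r : Fin 24) → P (toℕ r)
    table = toWitness {a? = all? λ r →
      ¬? (2 ∣? toℕ r) →-dec ¬? (3 ∣? toℕ r) →-dec toℕ r * toℕ r % 24 ≟ 1} _

  2∤n∧3∤n⇒n*n%24≡1 : ∀ n → 2 ∤ n → 3 ∤ n → n * n % 24 ≡ 1
  2∤n∧3∤n⇒n*n%24≡1 n 2∤n 3∤n = begin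
    n * n % 24                ≡⟨ %-distribˡ-* n n 24 ⟩
    n % 24 * (n % 24) % 24
      ≡⟨ r<24∧2∤r∧3∤r⇒r*r%24≡1 (m%n<n n 24) (∤-% (divides 12 refl) 2∤n) (∤-% (divides 8 refl) 3∤n) ⟩
    1                         ∎
    where
    open ≡-Reasoning

    ∤-% : ∀ {d} → d ∣ 24 → d ∤ n → d ∤ n % 24
    ∤-% d∣24 d∤n d∣n%24 = d∤n (∣n∣m%n⇒∣m d∣24 d∣n%24)

  prime≥5⇒p*p%24≡1 : ∀ {p} → Prime p → 5 ≤ p → p * p % 24 ≡ 1
  prime≥5⇒p*p%24≡1 {p} pr 5≤p = 2∤n∧3∤n⇒n*n%24≡1 p
    (prime⇒∤ pr (s<s z<s) (<-≤-trans (s<s (s<s z<s)) 5≤p))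
    (prime⇒∤ pr (s<s z<s) (<-≤-trans (s<s (s<s (s<s z<s))) 5≤p))

  m*n%o≡1∧n%o≡1⇒m%o≡1 : ∀ m n o .{{_ : NonZero o}} → m * n % o ≡ 1 → n % o ≡ 1 → m % o ≡ 1
  m*n%o≡1∧n%o≡1⇒m%o≡1 m n o mn%o≡1 n%o≡1 = begin
    m % o                 ≡⟨ m%n%n≡m%n m o ⟨
    m % o % o             ≡⟨ cong (_% o) (*-identityʳ (m % o)) ⟨
    m % o * 1 % o         ≡⟨ cong (λ x → m % o * x % o) n%o≡1 ⟨
    m % o * (n % o) % o   ≡⟨ %-distribˡ-* m n o ⟨
    m * n % o             ≡⟨ mn%o≡1 ⟩
    1                     ∎
    where open ≡-Reasoning

  m*j+r<m*p : ∀ m {j p r} → r < m → j < p → m * j + r < m * p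
  m*j+r<m*p m {j} {p} {r} r<m j<p = begin-strict
    m * j + r   <⟨ +-monoʳ-< (m * j) r<m ⟩
    m * j + m   ≡⟨ +-comm (m * j) m ⟩
    m + m * j   ≡⟨ *-suc m j ⟨
    m * suc j   ≤⟨ *-monoʳ-≤ m j<p ⟩
    m * p       ∎
    where open ≤-Reasoning

  [n*q+r]/n≡q : ∀ n q {r} .{{_ : NonZero n}} → r < n → (n * q + r) / n ≡ q
  [n*q+r]/n≡q n q {r} r<n = begin
    (n * q + r) / n       ≡⟨ +-distrib-/-∣ˡ r (m∣m*n q) ⟩
    n * q / n + r / n     ≡⟨ cong₂ _+_ (cong (_/ n) (*-comm n q)) (m<n⇒m/n≡0 r<n) ⟩
    q * n / n + 0         ≡⟨ cong (_+ 0) (m*n/n≡m q n) ⟩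
    q + 0                 ≡⟨ +-identityʳ q ⟩
    q                     ∎
    where open ≡-Reasoning

  p²∣24[pα+j]+1⇒α≡p/24 : ∀ {p j α} → Prime p → 5 ≤ p → j < p → p ∣ 24 * j + 1 → α < p →
           p * p ∣ 24 * (p * α + j) + 1 → α ≡ p / 24
  p²∣24[pα+j]+1⇒α≡p/24 {p@(suc _)} {j} {α} pr 5≤p j<p (divides k 24j+1≡kp) α<p p²∣N = begin
    α                     ≡⟨ [n*q+r]/n≡q 24 α k<24 ⟨
    (24 * α + k) / 24     ≡⟨ cong (_/ 24) 24α+k≡p ⟩
    p / 24                ∎
    where
    open ≡-Reasoning

    k<24 : k < 24
    k<24 = *-cancelʳ-< p k 24 (subst (_< 24 * p) 24j+1≡kp (m*j+r<m*p 24 (s<s z<s) j<p))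

    N≡[24α+k]p : 24 * (p * α + j) + 1 ≡ (24 * α + k) * p
    N≡[24α+k]p = begin
      24 * (p * α + j) + 1          ≡⟨ regroup p α j ⟩
      24 * α * p + (24 * j + 1)     ≡⟨ cong (24 * α * p +_) 24j+1≡kp ⟩
      24 * α * p + k * p            ≡⟨ *-distribʳ-+ p (24 * α) k ⟨
      (24 * α + k) * p              ∎
      where
      regroup : ∀ p α j → 24 * (p * α + j) + 1 ≡ 24 * α * p + (24 * j + 1)
      regroup = solve-∀

    24α+k≡p : 24 * α + k ≡ p
    24α+k≡p with *-cancelʳ-∣ p (subst (p * p ∣_) N≡[24α+k]p p²∣N)
    ... | divides m 24α+k≡mp = trans 24α+k≡mp (trans (cong (_* p) m≡1) (*-identityˡ p))
      where
      m<24 : m < 24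
      m<24 = *-cancelʳ-< p m 24 (subst (_< 24 * p) 24α+k≡mp (m*j+r<m*p 24 k<24 α<p))

      N≡m*p*p : 24 * (p * α + j) + 1 ≡ m * (p * p)
      N≡m*p*p = trans N≡[24α+k]p (trans (cong (_* p) 24α+k≡mp) (*-assoc m p p))

      m≡1 : m ≡ 1
      m≡1 = trans (sym (m<n⇒m%n≡m m<24))
        (m*n%o≡1∧n%o≡1⇒m%o≡1 m (p * p) 24
          (subst (λ N → N % 24 ≡ 1) N≡m*p*p (%-remove-+ˡ 1 (m∣m*n (p * α + j))))
          (prime≥5⇒p*p%24≡1 pr 5≤p))

open import Defs
open import Data.Nat using (ℕ; _≤_; _<_; _/_)
open import Data.Nat.Primality using (Prime)
open import Data.Integer using (ℤ; +_; _+_; _-_; _*_; -_)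
open import Data.Integer.Divisibility using (_∣_)
import Data.Integer as ℤ
open import Relation.Binary.PropositionalEquality using (_≢_)
open import Relation.Nullary using (¬_)

import Data.Nat as ℕ
import Data.Integer.Properties as ℤP
import Data.Nat.Properties as ℕP
import Data.Nat.Divisibility as ℕD
open import Relation.Binary.PropositionalEquality using (_≡_; cong; subst; trans; module ≡-Reasoning)
open ℕ-Arithmetic using (p²∣24[pα+j]+1⇒α≡p/24)

lemma2p2 : (p : ℕ) → Prime p → 5 ≤ p →
           (inv : ℤ) → (+ p ∣ (+ 24 * inv - + 1)) →
           + 1 ℤ.≤ - inv → - inv ℤ.≤ + p - + 1 →
           (α : ℕ) → α < p → α ≢ p / 24 →
           ¬ ((+ p * + p) ∣ (+ 24 * (+ p * + α - inv) + + 1))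
lemma2p2 _ _ _ (+ 0) _ (ℤ.+≤+ ()) _ _ _ _ _
lemma2p2 _ _ _ ℤ.+[1+ _ ] _ () _ _ _ _ _
-- Here j = suc n, and ℤ's _∣_ is ℕ's _∣_ on absolute values.
lemma2p2 p@(ℕ.suc _) pr 5≤p ℤ.-[1+ n ] p∣24inv-1 _ (ℤ.+≤+ j≤p-1) α α<p α≢p/24 p²∣N =
  α≢p/24 (p²∣24[pα+j]+1⇒α≡p/24 pr 5≤p (ℕ.s≤s j≤p-1) p∣24j+1 α<p
    (subst (p ℕ.* p ℕD.∣_) ∣N∣≡24[pα+j]+1 p²∣N))
  where
  p∣24j+1 : p ℕD.∣ 24 ℕ.* ℕ.suc n ℕ.+ 1
  p∣24j+1 = subst (p ℕD.∣_) (trans (cong ℕ.suc (ℕP.+-identityʳ _)) (ℕP.+-comm 1 _)) p∣24inv-1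

  ∣N∣≡24[pα+j]+1 : ℤ.∣ + 24 * (+ p * + α - ℤ.-[1+ n ]) + + 1 ∣ ≡ 24 ℕ.* (p ℕ.* α ℕ.+ ℕ.suc n) ℕ.+ 1
  ∣N∣≡24[pα+j]+1 = begin
    ℤ.∣ + 24 * (+ p * + α - ℤ.-[1+ n ]) + + 1 ∣
      ≡⟨ cong (λ x → ℤ.∣ + 24 * (x - ℤ.-[1+ n ]) + + 1 ∣) (ℤP.pos-* p α) ⟨
    ℤ.∣ + 24 * + (p ℕ.* α ℕ.+ ℕ.suc n) + + 1 ∣
      ≡⟨ cong (λ x → ℤ.∣ x + + 1 ∣) (ℤP.pos-* 24 (p ℕ.* α ℕ.+ ℕ.suc n)) ⟨
    24 ℕ.* (p ℕ.* α ℕ.+ ℕ.suc n) ℕ.+ 1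
      ∎
    where open ≡-Reasoning
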